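{- Let $k$ be a positive integer and $n,m$ integers with $0\le n,m\le k-1$ and $|[-n,m]|=k$. Then $\langle[-n,m];\Rightarrow,0\rangle\in\mathbf{I}_{2,0}$.
   Context: A zroupoid is an algebra $\langle A,\to,0\rangle$ with binary $\to$ and constant $0$; $x':=x\to 0$. An implication zroupoid satisfies (I) $(x\to y)\to z\approx[(z'\to x)\to(y\to z)']'$ and $0''\approx 0$; $\mathbf{I}_{2,0}$ is the variety of implication zroupoids satisfying $x''\approx x$. Construction: $[-n,m]=\{x\in\mathbb Z:-n\le x\le m\}$; $p(x)=x-1$ if $x>-n$, $p(-n)=-n$; $0^\ast=m$, $x^\ast=x$ for $x<0$, $x^\ast=p((p(x))^\ast)$ for $x>0$; $x\Rightarrow y=\max(x^\ast,y)$ if $x,y\ge0$ and $\min(x,y)$ otherwise; the constant is $0$, and $x':=x\Rightarrow 0$. -}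

module Defs where

open import Data.Nat using (ℕ; zero; suc)
open import Data.Integer using (ℤ; +_; -[1+_]; _-_; -_; _≤_; _<_; _<?_; _⊔_; _⊓_; 0ℤ; 1ℤ)
open import Data.Product using (_×_)
open import Relation.Nullary using (yes; no)
open import Relation.Binary.PropositionalEquality using (_≡_)

InRange : ℕ → ℕ → ℤ → Set
InRange n m x = (- (+ n) ≤ x) × (x ≤ + m)

-- p(x) = x - 1 if x > -n, and p(-n) = -n (within [-n,m], x ≤ -n means x = -n).
p : ℕ → ℤ → ℤ
p n x with (- (+ n)) <? x
... | yes _ = x - 1ℤ
... | no  _ = - (+ n)

-- x* for x ≥ 0: 0* = m, (j+1)* = p((p(j+1))*) = p(j*), since p(j+1) = j for j+1 > 0 ≥ -n.
star⁺ : ℕ → ℕ → ℕ → ℤ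
star⁺ n m zero    = + m
star⁺ n m (suc j) = p n (star⁺ n m j)

star : ℕ → ℕ → ℤ → ℤ
star n m (+ j)     = star⁺ n m j
star n m -[1+ j ]  = -[1+ j ]

imp : ℕ → ℕ → ℤ → ℤ → ℤ
imp n m (+ a)    (+ b)    = star n m (+ a) ⊔ + b
imp n m (+ a)    -[1+ b ] = + a ⊓ -[1+ b ]
imp n m -[1+ a ] y        = -[1+ a ] ⊓ y

-- The zroupoid ⟨[-n,m]; ⇒, 0⟩ lies in I_{2,0}: the carrier contains 0 and is closed
-- under ⇒ (so it is an algebra), identity (I) and 0'' = 0 hold, and x'' = x holds.
InI20 : ℕ → ℕ → Set
InI20 n m =
  InRange n m 0ℤ
  × (∀ x y → InRange n m x → InRange n m y → InRange n m (x ⇒ y))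
  × (∀ x y z → InRange n m x → InRange n m y → InRange n m z →
       (x ⇒ y) ⇒ z ≡ ′ ((′ z ⇒ x) ⇒ ′ (y ⇒ z)))
  × (′ (′ 0ℤ) ≡ 0ℤ)
  × (∀ x → InRange n m x → ′ (′ x) ≡ x)
  where
  _⇒_ : ℤ → ℤ → ℤ
  _⇒_ = imp n m
  ′ : ℤ → ℤ
  ′ x = x ⇒ 0ℤ

module Submission where

-- Write ~ a = m ∸ a.  On the non-negative part [0, m] of the carrier the
-- star operation is x* = m - x, so there x ⇒ y = ~ x ⊔ y is the Kleene
-- implication of the chain [0, m] with the involutive De Morgan complement
-- ~, and x' = ~ x.  In that form identity (I) reads
--   (a ⟶ b) ⟶ c = ~ ((~ c ⟶ a) ⟶ ~ (b ⟶ c)),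
-- and both sides equal (a ⊓ ~ b) ⊔ c by the De Morgan laws, involutivity of
-- ~ and distributivity.  As soon as one argument is negative, x ⇒ y = min x y,
-- and on the negative part min is a semilattice operation; so every instance
-- of (I) with a negative argument reduces, after evaluating the
-- non-negative subterms, to a semilattice identity on ℕ, settled by the
-- idempotent commutative monoid solver.

open import Defs
open import Data.Nat using (ℕ; zero; suc; _+_; _∸_; _⊔_; _⊓_; _≤_; s≤s; z≤n)
open import Data.Nat.Properties
  using (≤-trans; n≤1+n; +-∸-assoc; m∸n≤m; m∸[m∸n]≡n; ∸-distribˡ-⊔-⊓;
         ⊔-identityʳ; ⊔-lub; ⊔-comm; ⊔-idem; ⊔-distribʳ-⊓;
         ⊔-0-isCommutativeMonoid)
open import Data.Integer as ℤ using (ℤ; +_; -[1+_]; -≤-; -≤+; +≤+; +<+; -<+; 0ℤ)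
open import Data.Integer.Properties using (drop‿+≤+; [1+m]⊖[1+n]≡m⊖n)
open import Data.Product using (_,_)
open import Relation.Nullary using (yes; no)
open import Relation.Binary.PropositionalEquality
  using (_≡_; refl; trans; cong; cong₂; module ≡-Reasoning)
open import Data.Empty using (⊥-elim)
open import Algebra.Bundles using (IdempotentCommutativeMonoid)
import Algebra.Solver.IdempotentCommutativeMonoid as ICM-Solver

⊔-0-idempotentCommutativeMonoid : IdempotentCommutativeMonoid _ _
⊔-0-idempotentCommutativeMonoid = record
  { isIdempotentCommutativeMonoid = record
    { isCommutativeMonoid = ⊔-0-isCommutativeMonoid
    ; idem                = ⊔-idem
    }
  }

open ICM-Solver ⊔-0-idempotentCommutativeMonoid using (solve; _⊜_; _⊕_)

module Kleene (m : ℕ) where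

  ~_ : ℕ → ℕ
  ~ a = m ∸ a

  infixr 5 _⟶_
  _⟶_ : ℕ → ℕ → ℕ
  a ⟶ b = ~ a ⊔ b

  ~-involutive : ∀ {a} → a ≤ m → ~ ~ a ≡ a
  ~-involutive = m∸[m∸n]≡n

  ~-⊔ : ∀ a b → ~ (a ⊔ b) ≡ ~ a ⊓ ~ b
  ~-⊔ = ∸-distribˡ-⊔-⊓ m

  -- [0, m] is closed under ⟶ (needed since ~ is involutive only there).
  ⟶-bounded : ∀ a {b} → b ≤ m → a ⟶ b ≤ m
  ⟶-bounded a b≤m = ⊔-lub (m∸n≤m m a) b≤m

  ⟶-identity : ∀ {a b c} → a ≤ m → b ≤ m → c ≤ m →
               (a ⟶ b) ⟶ c ≡ ~ ((~ c ⟶ a) ⟶ ~ (b ⟶ c))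
  ⟶-identity {a} {b} {c} a≤m b≤m c≤m = begin
    ~ (~ a ⊔ b) ⊔ c                  ≡⟨ cong (_⊔ c) (~-⊔ (~ a) b) ⟩
    (~ ~ a ⊓ ~ b) ⊔ c                ≡⟨ cong (λ t → (t ⊓ ~ b) ⊔ c) (~-involutive a≤m) ⟩
    (a ⊓ ~ b) ⊔ c                    ≡⟨ ⊔-distribʳ-⊓ c a (~ b) ⟩
    (a ⊔ c) ⊓ (~ b ⊔ c)              ≡⟨ cong₂ _⊓_ (⊔-comm a c) refl ⟩
    (c ⊔ a) ⊓ (~ b ⊔ c)              ≡⟨ cong₂ (λ s t → (s ⊔ a) ⊓ t) (~-involutive c≤m) refl ⟨
    (~ ~ c ⊔ a) ⊓ (b ⟶ c)            ≡⟨ cong₂ _⊓_ (~-involutive (⟶-bounded (~ c) a≤m))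
                                                  (~-involutive (⟶-bounded b c≤m)) ⟨
    ~ ~ (~ c ⟶ a) ⊓ ~ ~ (b ⟶ c)      ≡⟨ ~-⊔ (~ (~ c ⟶ a)) (~ (b ⟶ c)) ⟨
    ~ ((~ c ⟶ a) ⟶ ~ (b ⟶ c))        ∎
    where open ≡-Reasoning

  ⟶0-involutive : ∀ {a} → a ≤ m → (a ⟶ 0) ⟶ 0 ≡ a
  ⟶0-involutive {a} a≤m = begin
    ~ (~ a ⊔ 0) ⊔ 0  ≡⟨ ⊔-identityʳ _ ⟩
    ~ (~ a ⊔ 0)      ≡⟨ cong ~_ (⊔-identityʳ (~ a)) ⟩
    ~ ~ a            ≡⟨ ~-involutive a≤m ⟩
    a                ∎
    where open ≡-Reasoning

m∸j≡1+m∸[1+j] : ∀ {m j} → suc j ≤ m → m ∸ j ≡ suc (m ∸ suc j)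
m∸j≡1+m∸[1+j] {suc m} (s≤s j≤m) = +-∸-assoc 1 j≤m

-ℕ≤+ : ∀ n k → ℤ.- (+ n) ℤ.≤ + k
-ℕ≤+ zero    k = +≤+ z≤n
-ℕ≤+ (suc n) k = -≤+

-ℕ<+suc : ∀ n k → ℤ.- (+ n) ℤ.< + suc k
-ℕ<+suc zero    k = +<+ (s≤s z≤n)
-ℕ<+suc (suc n) k = -<+

-ℕ≤-[1+⊔] : ∀ {n a b} → ℤ.- (+ n) ℤ.≤ -[1+ a ] → ℤ.- (+ n) ℤ.≤ -[1+ b ] →
            ℤ.- (+ n) ℤ.≤ -[1+ a ⊔ b ]
-ℕ≤-[1+⊔] {suc n} (-≤- a≤n) (-≤- b≤n) = -≤- (⊔-lub a≤n b≤n)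

p-suc : ∀ n k → p n (+ suc k) ≡ + k
p-suc n k with ℤ.- (+ n) ℤ.<? + suc k
... | yes _  = [1+m]⊖[1+n]≡m⊖n k 0
... | no -n≮ = ⊥-elim (-n≮ (-ℕ<+suc n k))

star⁺-complement : ∀ n m {j} → j ≤ m → star⁺ n m j ≡ + (m ∸ j)
star⁺-complement n m {zero}  _   = refl
star⁺-complement n m {suc j} j<m = begin
  p n (star⁺ n m j)          ≡⟨ cong (p n) (star⁺-complement n m (≤-trans (n≤1+n j) j<m)) ⟩
  p n (+ (m ∸ j))            ≡⟨ cong (λ t → p n (+ t)) (m∸j≡1+m∸[1+j] j<m) ⟩
  p n (+ suc (m ∸ suc j))    ≡⟨ p-suc n (m ∸ suc j) ⟩
  + (m ∸ suc j)              ∎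
  where open ≡-Reasoning

module Zroupoid (n m : ℕ) where
  open Kleene m

  _⇒_ : ℤ → ℤ → ℤ
  _⇒_ = imp n m

  ′ : ℤ → ℤ
  ′ x = x ⇒ 0ℤ

  I : ℤ → Set
  I = InRange n m

  bound : ∀ {a} → I (+ a) → a ≤ m
  bound (_ , a≤m) = drop‿+≤+ a≤m

  ⇒-nonneg : ∀ {a} b → a ≤ m → (+ a) ⇒ (+ b) ≡ + (a ⟶ b)
  ⇒-nonneg b a≤m = cong (ℤ._⊔ + b) (star⁺-complement n m a≤m)

  ′-nonneg : ∀ {a} → a ≤ m → ′ (+ a) ≡ + (~ a)
  ′-nonneg {a} a≤m = trans (⇒-nonneg 0 a≤m) (cong +_ (⊔-identityʳ (~ a)))

  closed : ∀ x y → I x → I y → I (x ⇒ y)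
  closed (+ a) (+ b) x∈ y∈ rewrite ⇒-nonneg b (bound x∈) =
    -ℕ≤+ n _ , +≤+ (⟶-bounded a (bound y∈))
  closed (+ a) -[1+ b ] x∈ y∈ = y∈
  closed -[1+ a ] (+ b) x∈ y∈ = x∈
  closed -[1+ a ] -[1+ b ] (-n≤x , _) (-n≤y , _) = -ℕ≤-[1+⊔] -n≤x -n≤y , -≤+

  identity : ∀ x y z → I x → I y → I z →
             (x ⇒ y) ⇒ z ≡ ′ ((′ z ⇒ x) ⇒ ′ (y ⇒ z))
  identity (+ a) (+ b) (+ c) x∈ y∈ z∈ = begin
    ((+ a) ⇒ (+ b)) ⇒ (+ c)                   ≡⟨ cong (_⇒ (+ c)) (⇒-nonneg b a≤m) ⟩
    (+ (a ⟶ b)) ⇒ (+ c)                       ≡⟨ ⇒-nonneg c (⟶-bounded a b≤m) ⟩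
    + ((a ⟶ b) ⟶ c)                           ≡⟨ cong +_ (⟶-identity a≤m b≤m c≤m) ⟩
    + (~ ((~ c ⟶ a) ⟶ ~ (b ⟶ c)))             ≡⟨ ′-nonneg (⟶-bounded (~ c ⟶ a) (m∸n≤m m (b ⟶ c))) ⟨
    ′ (+ ((~ c ⟶ a) ⟶ ~ (b ⟶ c)))             ≡⟨ cong ′ (⇒-nonneg _ (⟶-bounded (~ c) a≤m)) ⟨
    ′ ((+ (~ c ⟶ a)) ⇒ (+ (~ (b ⟶ c))))       ≡⟨ cong ′ (cong₂ _⇒_ (⇒-nonneg a (m∸n≤m m c))
                                                                  (′-nonneg (⟶-bounded b c≤m))) ⟨
    ′ (((+ (~ c)) ⇒ (+ a)) ⇒ ′ (+ (b ⟶ c)))   ≡⟨ cong ′ (cong₂ _⇒_ (cong (_⇒ (+ a)) (′-nonneg c≤m))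
                                                                  (cong ′ (⇒-nonneg c b≤m))) ⟨
    ′ ((′ (+ c) ⇒ (+ a)) ⇒ ′ ((+ b) ⇒ (+ c)))  ∎
    where
    open ≡-Reasoning
    a≤m = bound x∈
    b≤m = bound y∈
    c≤m = bound z∈
  identity (+ a) (+ b) -[1+ c ] x∈ _ _ rewrite ⇒-nonneg b (bound x∈) =
    cong -[1+_] (solve 1 (λ c → c ⊜ c ⊕ c) refl c)
  identity (+ a) -[1+ b ] (+ c) _ _ z∈
    rewrite ′-nonneg (bound z∈) | ⇒-nonneg a (m∸n≤m m c) = refl
  identity (+ a) -[1+ b ] -[1+ c ] _ _ _ =
    cong -[1+_] (solve 2 (λ b c → b ⊕ c ⊜ c ⊕ (b ⊕ c)) refl b c)
  identity -[1+ a ] (+ b) (+ c) _ y∈ z∈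
    rewrite ′-nonneg (bound z∈) | ⇒-nonneg c (bound y∈)
          | ′-nonneg (⟶-bounded b (bound z∈)) = refl
  identity -[1+ a ] (+ b) -[1+ c ] _ _ _ =
    cong -[1+_] (solve 2 (λ a c → a ⊕ c ⊜ (c ⊕ a) ⊕ c) refl a c)
  identity -[1+ a ] -[1+ b ] (+ c) _ _ z∈ rewrite ′-nonneg (bound z∈) = refl
  identity -[1+ a ] -[1+ b ] -[1+ c ] _ _ _ =
    cong -[1+_] (solve 3 (λ a b c → (a ⊕ b) ⊕ c ⊜ (c ⊕ a) ⊕ (b ⊕ c)) refl a b c)

  involutive : ∀ x → I x → ′ (′ x) ≡ x
  involutive (+ a) x∈ = begin
    ′ (′ (+ a))       ≡⟨ cong ′ (⇒-nonneg 0 (bound x∈)) ⟩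
    ′ (+ (a ⟶ 0))     ≡⟨ ⇒-nonneg 0 (⟶-bounded a z≤n) ⟩
    + ((a ⟶ 0) ⟶ 0)   ≡⟨ cong +_ (⟶0-involutive (bound x∈)) ⟩
    + a               ∎
    where open ≡-Reasoning
  involutive -[1+ a ] _ = refl

  0∈ : I 0ℤ
  0∈ = -ℕ≤+ n 0 , +≤+ z≤n

-- ⟨[-n, m]; ⇒, 0⟩ ∈ I_{2,0}.
lemma4p7 : (k n m : ℕ) → 1 ≤ k → n ≤ k ∸ 1 → m ≤ k ∸ 1 → n + m + 1 ≡ k →
    InI20 n m
lemma4p7 _ n m _ _ _ _ =
  0∈ , closed , identity , involutive 0ℤ 0∈ , involutive
  where open Zroupoid n m
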